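{- Over the class of $c$-frames and under the semantics $\Vvdash$, each of the following formulas defines the listed property (i.e., for every $c$-frame $\mathcal{F}$, the formula is valid on $\mathcal{F}$ iff $\mathcal{F}$ has the property): $\Delta\top$ defines $(n)$; $\Delta p\land\Delta q\to\Delta(p\land q)$ defines $(i)$; $\Delta(p\land q)\to\Delta p\land\Delta q$ defines $(s)$; $\Delta p\leftrightarrow\Delta\neg p$ defines $(c)$; $\nabla p$ defines $(d)$; $\Delta p\to p$ defines $(t)$; $p\to\Delta\nabla p$ defines $(b)$; $\Delta p\to\Delta\Delta p$ defines $(4)$; $\nabla p\to\Delta\nabla p$ defines $(5)$.
   Context: $\mathcal{L}_\Delta$: $\phi::=p\mid\neg\phi\mid(\phi\land\phi)\mid\Delta\phi$ ($p$ in a countable set $\mathbf{Prop}$), with $\nabla\phi:=\neg\Delta\phi$ and usual Boolean abbreviations. A neighborhood frame is $\mathcal{F}=\langle S,N\rangle$ with $S\neq\emptyset$, $N:S\to 2^{2^S}$; a model on it adds $V:\mathbf{Prop}\to 2^S$. Semantics $\Vvdash$: $s\Vvdash p$ iff $s\in V(p)$, Boolean clauses standard, $\mathcal{M},s\Vvdash\Delta\phi$ iff $\phi^{\mathcal{M}}=\{t:\mathcal{M},t\Vvdash\phi\}\in N(s)$. A formula is valid on $\mathcal{F}$ if it is true at every state of every model based on $\mathcal{F}$. A frame has a property if $N(s)$ has it for every $s\in S$, where: $(n)$ $S\in N(s)$; $(i)$ $X,Y\in N(s)$ implies $X\cap Y\in N(s)$; $(s)$ $X\in N(s)$ and $X\subseteq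 Y\subseteq S$ imply $Y\in N(s)$; $(c)$ $X\in N(s)$ implies $S\setminus X\in N(s)$; $(d)$ $X\in N(s)$ implies $S\setminus X\notin N(s)$; $(t)$ $X\in N(s)$ implies $s\in X$; $(b)$ $s\in X$ implies $\{u\in S: S\setminus X\notin N(u)\}\in N(s)$; $(4)$ $X\in N(s)$ implies $\{u: X\in N(u)\}\in N(s)$; $(5)$ $X\notin N(s)$ implies $\{u: X\notin N(u)\}\in N(s)$. A $c$-frame is a frame with property $(c)$. -}

module Defs where

open import Data.Nat using (ℕ)
open import Data.Bool using (Bool; true; false; not; _∧_)
open import Data.Product using (_×_)
open import Relation.Binary.PropositionalEquality using (_≡_)
open import Function.Bundles using (_⇔_)

-- Subsets of S are characteristic functions S → Bool (literally 2^S).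

-- Neighborhood frames: S nonempty, N : S → 2^(2^S).
-- N must respect equality of subsets (pointwise equality of
-- characteristic functions), since N(s) is a set of subsets.
record Frame : Set₁ where
  field
    S     : Set
    point : S
    N     : S → (S → Bool) → Bool
    N-ext : ∀ s (X Y : S → Bool) → (∀ u → X u ≡ Y u) → N s X ≡ N s Y
open Frame public

data Form : Set where
  var : ℕ → Form
  ¬'_ : Form → Form
  _∧'_ : Form → Form → Form
  Δ_ : Form → Form

infix  9 ¬'_ Δ_ ∇_
infixl 7 _∧'_
infixr 6 _→'_ _↔'_

∇_ : Form → Form
∇ φ = ¬' Δ φ

_→'_ : Form → Form → Form
φ →' ψ = ¬' (φ ∧' ¬' ψ)

_↔'_ : Form → Form → Form
φ ↔' ψ = (φ →' ψ) ∧' (ψ →' φ)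

⊤' : Form
⊤' = ¬' (var 0 ∧' ¬' var 0)

p q : Form
p = var 0
q = var 1

Valuation : Frame → Set
Valuation F = ℕ → S F → Bool

⟦_⟧ : ∀ {F} → Form → Valuation F → S F → Bool
⟦_⟧ {F} (var n) V s = V n s
⟦_⟧ {F} (¬' φ) V s = not (⟦_⟧ {F} φ V s)
⟦_⟧ {F} (φ ∧' ψ) V s = ⟦_⟧ {F} φ V s ∧ ⟦_⟧ {F} ψ V s
⟦_⟧ {F} (Δ φ) V s = N F s (⟦_⟧ {F} φ V)

Valid : Frame → Form → Set
Valid F φ = ∀ (V : Valuation F) (s : S F) → ⟦_⟧ {F} φ V s ≡ true

_⊆_ : ∀ {F} → (S F → Bool) → (S F → Bool) → Set
_⊆_ {F} X Y = ∀ (u : S F) → X u ≡ true → Y u ≡ true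

HasN HasI HasS HasC HasD HasT HasB Has4 Has5 : Frame → Set
HasN F = ∀ s → N F s (λ _ → true) ≡ true
HasI F = ∀ s (X Y : S F → Bool) → N F s X ≡ true → N F s Y ≡ true →
         N F s (λ u → X u ∧ Y u) ≡ true
HasS F = ∀ s (X Y : S F → Bool) → N F s X ≡ true → _⊆_ {F} X Y → N F s Y ≡ true
HasC F = ∀ s (X : S F → Bool) → N F s X ≡ true → N F s (λ u → not (X u)) ≡ true
HasD F = ∀ s (X : S F → Bool) → N F s X ≡ true → N F s (λ u → not (X u)) ≡ false
HasT F = ∀ s (X : S F → Bool) → N F s X ≡ true → X s ≡ true
HasB F = ∀ s (X : S F → Bool) → X s ≡ true →
         N F s (λ u → not (N F u (λ v → not (X v)))) ≡ true
Has4 F = ∀ s (X : S F → Bool) → N F s X ≡ true → N F s (λ u → N F u X) ≡ true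
Has5 F = ∀ s (X : S F → Bool) → N F s X ≡ false → N F s (λ u → not (N F u X)) ≡ true

Defines : Frame → Form → (Frame → Set) → Set
Defines F φ P = Valid F φ ⇔ P F

-- Each schema mentions only p (and q), so instantiating p and q at arbitrary
-- subsets X and Y turns validity into the frame condition, and conversely the
-- frame condition applied to the truth sets of p and q gives validity.
-- Only (d) and (b) use that the frame is a c-frame: both compare membership
-- of a set and of its complement in a neighbourhood, which (c) makes equal.
module Submission where

open import Defs
open import Data.Product using (_×_; _,_)
open import Data.Nat using (suc)
open import Data.Bool using (Bool; true; false; not; _∧_)
open import Data.Bool.Properties using (not-involutive; not-¬; ∧-inverseʳ)
open import Data.Empty using (⊥; ⊥-elim)
open import Relation.Binary.PropositionalEquality using (_≡_; refl; sym; trans; cong)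
open import Function.Bundles using (mk⇔)

⇒-intro : ∀ {a b : Bool} → (a ≡ true → b ≡ true) → not (a ∧ not b) ≡ true
⇒-intro {false} f = refl
⇒-intro {true} {true} f = refl
⇒-intro {true} {false} f = f refl

⇒-elim : ∀ {a b : Bool} → not (a ∧ not b) ≡ true → a ≡ true → b ≡ true
⇒-elim {true} {true} _ _ = refl

∧-intro : ∀ {a b : Bool} → a ≡ true → b ≡ true → a ∧ b ≡ true
∧-intro refl refl = refl

∧-elimˡ : ∀ {a b : Bool} → a ∧ b ≡ true → a ≡ true
∧-elimˡ {true} _ = refl

∧-elimʳ : ∀ {a b : Bool} → a ∧ b ≡ true → b ≡ true
∧-elimʳ {true} e = e

not≡true⇒≡false : ∀ {a : Bool} → not a ≡ true → a ≡ false
not≡true⇒≡false {false} _ = refl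

≢true⇒not≡true : ∀ {a : Bool} → (a ≡ true → ⊥) → not a ≡ true
≢true⇒not≡true {false} _ = refl
≢true⇒not≡true {true} f = ⊥-elim (f refl)

non-contradiction : ∀ b → not (b ∧ not b) ≡ true
non-contradiction b = cong not (∧-inverseʳ b)

⇒-∧-absorb : ∀ {a b : Bool} → (a ≡ true → b ≡ true) → b ∧ a ≡ a
⇒-∧-absorb {true} f = ∧-intro (f refl) refl
⇒-∧-absorb {false} {true} _ = refl
⇒-∧-absorb {false} {false} _ = refl

⇔⇒≡ : ∀ {a b : Bool} → (a ≡ true → b ≡ true) → (b ≡ true → a ≡ true) → a ≡ b
⇔⇒≡ {true} f _ = sym (f refl)
⇔⇒≡ {false} {true} _ g = g refl
⇔⇒≡ {false} {false} _ _ = refl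

module _ (F : Frame) where

  valuation : (S F → Bool) → (S F → Bool) → Valuation F
  valuation X Y 0 = X
  valuation X Y (suc _) = Y

  N-subst : ∀ s {X Y : S F → Bool} → N F s X ≡ true → (∀ u → X u ≡ Y u) → N F s Y ≡ true
  N-subst s {X} {Y} e X≗Y = trans (sym (N-ext F s X Y X≗Y)) e

  N-complement : HasC F → ∀ u (X : S F → Bool) → N F u (λ v → not (X v)) ≡ N F u X
  N-complement c u X = ⇔⇒≡
    (λ e → N-subst u (c u _ e) (λ v → not-involutive (X v)))
    (c u X)

  defines-n : Defines F (Δ ⊤') HasN
  defines-n = mk⇔
    (λ v s → N-subst s (v (valuation X⊤ X⊤) s) (λ _ → refl))
    (λ n V s → N-subst s (n s) (λ u → sym (non-contradiction (V 0 u))))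
    where
    X⊤ : S F → Bool
    X⊤ _ = true

  defines-i : Defines F (Δ p ∧' Δ q →' Δ (p ∧' q)) HasI
  defines-i = mk⇔
    (λ v s X Y X∈N Y∈N → ⇒-elim (v (valuation X Y) s) (∧-intro X∈N Y∈N))
    (λ i V s → ⇒-intro (λ e → i s _ _ (∧-elimˡ e) (∧-elimʳ e)))

  defines-s : Defines F (Δ (p ∧' q) →' Δ p ∧' Δ q) HasS
  defines-s = mk⇔
    (λ v s X Y X∈N X⊆Y → ∧-elimˡ {b = N F s X}
      (⇒-elim (v (valuation Y X) s) (N-subst s X∈N (λ u → sym (⇒-∧-absorb (X⊆Y u))))))
    (λ m V s → ⇒-intro (λ e →
      ∧-intro (m s _ _ e (λ _ → ∧-elimˡ)) (m s _ _ e (λ _ → ∧-elimʳ))))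

  defines-c : Defines F (Δ p ↔' Δ (¬' p)) HasC
  defines-c = mk⇔
    (λ v s X X∈N → ⇒-elim (∧-elimˡ (v (valuation X X) s)) X∈N)
    (λ c V s → ∧-intro
      (⇒-intro (c s _))
      (⇒-intro (λ e → N-subst s (c s _ e) (λ u → not-involutive (V 0 u)))))

  defines-d : HasC F → Defines F (∇ p) HasD
  defines-d c = mk⇔
    (λ v s X X∈N → ⊥-elim (not-¬ X∈N (not≡true⇒≡false (v (valuation X X) s))))
    (λ d V s → ≢true⇒not≡true (λ e → not-¬ (c s (V 0) e) (d s (V 0) e)))

  defines-t : Defines F (Δ p →' p) HasT
  defines-t = mk⇔
    (λ v s X X∈N → ⇒-elim (v (valuation X X) s) X∈N)
    (λ t V s → ⇒-intro (t s (V 0)))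

  defines-b : HasC F → Defines F (p →' Δ (∇ p)) HasB
  defines-b c = mk⇔
    (λ v s X Xs → N-subst s (⇒-elim (v (valuation X X) s) Xs)
                    (λ u → cong not (sym (N-complement c u X))))
    (λ b V s → ⇒-intro (λ e → N-subst s (b s (V 0) e)
                    (λ u → cong not (N-complement c u (V 0)))))

  defines-4 : Defines F (Δ p →' Δ (Δ p)) Has4
  defines-4 = mk⇔
    (λ v s X X∈N → ⇒-elim (v (valuation X X) s) X∈N)
    (λ h V s → ⇒-intro (h s (V 0)))

  defines-5 : Defines F (∇ p →' Δ (∇ p)) Has5
  defines-5 = mk⇔
    (λ v s X X∉N → ⇒-elim (v (valuation X X) s) (cong not X∉N))
    (λ h V s → ⇒-intro (λ e → h s (V 0) (not≡true⇒≡false e)))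

proposition16 : (F : Frame) → HasC F →
    Defines F (Δ ⊤') HasN
    × Defines F (Δ p ∧' Δ q →' Δ (p ∧' q)) HasI
    × Defines F (Δ (p ∧' q) →' Δ p ∧' Δ q) HasS
    × Defines F (Δ p ↔' Δ (¬' p)) HasC
    × Defines F (∇ p) HasD
    × Defines F (Δ p →' p) HasT
    × Defines F (p →' Δ (∇ p)) HasB
    × Defines F (Δ p →' Δ (Δ p)) Has4
    × Defines F (∇ p →' Δ (∇ p)) Has5
proposition16 F c =
  defines-n F , defines-i F , defines-s F , defines-c F , defines-d F c ,
  defines-t F , defines-b F c , defines-4 F , defines-5 F
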